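{- Let $k\ge 2$ and let $H$ be the full-$k$-star with vertex set $V=\{0\}\cup[n]$ and center $0$. Let $e_1,\dots,e_t$ be $k$-subsets of $V\setminus\{0\}$ such that $\partial_{k-1}(e_i)\cap\partial_{k-1}(e_j)=\emptyset$ for all $i\ne j$, and for each $1\le i\le t$ let $f_i$ be any $(k-1)$-subset of $e_i$. Let $H'$ be the $k$-uniform hypergraph obtained from $H$ by adding the edges $e_1,\dots,e_t$ and deleting the edges $\{0\}\cup f_i$ for $1\le i\le t$. Then $H'$ is tight-cycle-free and has the same number of edges as $H$, namely $\binom{n}{k-1}$.
   Context: $[n]=\{1,\dots,n\}$. The full-$k$-star on vertex set $V$ with center $x\in V$ is the $k$-uniform hypergraph whose edges are all $k$-subsets of $V$ containing $x$. For a $k$-set $e$, $\partial_{k-1}(e)$ is the set of all $(k-1)$-subsets of $e$. For $\ell\ge k+1$, the tight cycle $TC_\ell^k$ is the $k$-uniform hypergraph on $\ell$ distinct vertices $v_0,\dots,v_{\ell-1}$ with edges $\{v_i,\dots,v_{i+k-1}\}$ (subscripts mod $\ell$); a $k$-uniform hypergraph is tight-cycle-free if it contains no subhypergraph isomorphic to $TC_\ell^k$ for any $\ell\ge k+1$. -}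

module Defs where

open import Data.Nat using (ℕ; zero; suc; _+_; _∸_; _<_; _≤_)
open import Data.Nat.DivMod using (_mod_)
open import Data.Bool using (Bool; true; false; _∧_; _∨_; not; T)
import Data.Bool as B
open import Data.Fin using (Fin; toℕ) renaming (zero to fzero)
open import Data.Fin.Subset using (Subset; inside; outside; ⁅_⁆; _∪_; ⊥; ∣_∣)
open import Data.Fin.Subset.Properties using (_∈?_)
open import Data.List using (List; []; _∷_; _++_; map; filter; length; foldr; upTo; allFin)
open import Data.Bool.ListAction using (any)
open import Data.Vec using (Vec) renaming ([] to v[]; _∷_ to _v∷_)
open import Data.Vec.Properties using (≡-dec)
open import Data.Nat.Properties using () renaming (_≟_ to _≟ℕ_)
open import Relation.Nullary using (¬_)
open import Relation.Nullary.Decidable using (⌊_⌋)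
open import Function.Definitions using (Injective)
open import Relation.Binary.PropositionalEquality using (_≡_)

Hypergraph : ℕ → Set
Hypergraph N = Subset N → Bool

_≟S_ : ∀ {N} (a b : Subset N) → Bool
a ≟S b = ⌊ ≡-dec B._≟_ a b ⌋

allSubsets : (N : ℕ) → List (Subset N)
allSubsets zero = v[] ∷ []
allSubsets (suc N) = map (inside v∷_) (allSubsets N) ++ map (outside v∷_) (allSubsets N)

edgeCount : ∀ {N} → Hypergraph N → ℕ
edgeCount {N} H = length (filter (λ s → B.T? (H s)) (allSubsets N))

setOf : ∀ {N} → List (Fin N) → Subset N
setOf = foldr (λ x s → ⁅ x ⁆ ∪ s) ⊥

window : ∀ {N} (k m : ℕ) → (Fin (suc m) → Fin N) → Fin (suc m) → Subset N
window k m v i = setOf (map (λ j → v ((toℕ i + j) mod (suc m))) (upTo k))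

-- H contains a copy of the tight cycle TC^k_ℓ with ℓ = suc m vertices:
-- an injective map of the cycle's vertices v_0..v_{ℓ-1} into V such that
-- every edge {v_i,...,v_{i+k-1}} of TC^k_ℓ is an edge of H.
ContainsTightCycle : ∀ {N} (k : ℕ) → Hypergraph N → (ℓ : ℕ) → Set
ContainsTightCycle {N} k H zero = Data.Empty.⊥
  where import Data.Empty
ContainsTightCycle {N} k H (suc m) =
  Data.Product.Σ (Fin (suc m) → Fin N) λ v →
    Injective _≡_ _≡_ v Data.Product.× (∀ i → T (H (window k m v i)))
  where import Data.Product

TightCycleFree : ∀ {N} (k : ℕ) → Hypergraph N → Set
TightCycleFree k H = ∀ ℓ → suc k ≤ ℓ → ¬ ContainsTightCycle k H ℓ

-- full k-star on V = Fin (suc n) (vertex fzero plays the role of 0,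
-- vertex (suc j) the role of j+1 ∈ [n]) with center fzero
fullStar : (n k : ℕ) → Hypergraph (suc n)
fullStar n k e = ⌊ ∣ e ∣ ≟ℕ k ⌋ ∧ ⌊ fzero ∈? e ⌋

modifiedStar : (n k t : ℕ) → (Fin t → Subset (suc n)) → (Fin t → Subset (suc n)) → Hypergraph (suc n)
modifiedStar n k t es fs e =
  (fullStar n k e ∧ not (any (λ i → e ≟S (⁅ fzero ⁆ ∪ fs i)) (allFin t)))
  ∨ any (λ i → e ≟S es i) (allFin t)

-- The
-- star is split into the surviving star edges and the t deleted edges
-- {0} ∪ fᵢ; the new hypergraph into the surviving star edges and the t added
-- edges eᵢ.  Both families have exactly t members (their indexing maps are
-- injective by the disjointness of shadows), so the two counts agree.  The
-- star itself has C(n, k-1) edges: a k-set containing 0 is 0 plus a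
-- (k-1)-subset of [n].
--
-- Extend a cycle v₀ … v_{ℓ-1} periodically to u : ℕ → V and
-- let W s = {u s, …, u (s+k-1)} be its windows, all edges of H'.  A window
-- missing 0 is an added edge eₐ, and two consecutive windows are never both
-- added edges: for different a ≠ b the set eₐ - u s is a common (k-1)-subset,
-- for a = b the vertex u s would recur within the next window.  If 0 is not on
-- the cycle, windows 0 and 1 contradict this; if u P = 0 and ℓ ≥ k+2, windows
-- P+1 and P+2 do.  In the remaining case ℓ = k+1 the window P+1 is some eₐ;
-- choosing x = u X in eₐ outside fₐ, the window after x is exactly the
-- deleted edge {0} ∪ fₐ, which is not an edge of H'.

module Submission where

open import Defs
open import Data.Nat using (ℕ; zero; suc; _+_; _∸_; _<_; _≤_; z≤n; s≤s; s≤s⁻¹; _%_; _<?_; _≤?_)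
  renaming (_≟_ to _≟ℕ_)
open import Data.Nat.Properties
open import Data.Nat.DivMod using (_mod_; m<n⇒m%n≡m; %-distribˡ-+; m%n%n≡m%n; [m+n]%n≡m%n; m%n<n; m≤n⇒[n∸m]%m≡n%m)
open import Data.Nat.Combinatorics using (_C_; nCk+nC[k+1]≡[n+1]C[k+1])
open import Data.Bool using (Bool; true; false; _∧_; _∨_; not; T)
import Data.Bool as B
open import Data.Bool.Properties using (T-∧; T-∨; ∧-identityʳ; ∧-zeroʳ)
open import Data.Unit using (tt)
open import Data.Empty using (⊥-elim) renaming (⊥ to Empty)
open import Data.Fin using (Fin; toℕ) renaming (zero to fzero; suc to fsuc; _≟_ to _≟F_)
open import Data.Fin.Properties using (toℕ-fromℕ<; toℕ-injective; toℕ<n; any?)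
open import Data.Fin.Subset using (Subset; inside; outside; ⁅_⁆; _∪_; ∣_∣; _∈_; _∉_; _⊆_; _⊂_; _-_)
open import Data.Fin.Subset.Properties
  using (_∈?_; ∉⊥; x∈⁅x⁆; x∈⁅y⁆⇒x≡y; x∈p∪q⁺; x∈p∪q⁻; p─q⊆p; x∈p∧x≢y⇒x∈p-y; ⊆-antisym; p⊆q⇒∣p∣≤∣q∣; p⊂q⇒∣p∣<∣q∣; ∪-identityˡ; p─⊥≡p)
open import Data.List using (List; []; _∷_; _++_; map; filter; length; allFin)
open import Data.List.Properties using (length-tabulate)
open import Data.Bool.ListAction using (any)
open import Data.List.Membership.Propositional using (lose; find) renaming (_∈_ to _∈ₗ_)
open import Data.List.Membership.Propositional.Properties using (∈-map⁺; ∈-map⁻; ∈-upTo⁺; ∈-upTo⁻; ∈-allFin)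
open import Data.List.Relation.Unary.Any using (here; there)
import Data.List.Relation.Unary.Any.Properties as Any
import Data.List.Relation.Unary.All as All
open import Data.List.Relation.Unary.Unique.Propositional using (Unique; []; _∷_)
open import Data.List.Relation.Unary.Unique.Propositional.Properties using (allFin⁺)
open import Data.Vec using () renaming ([] to v[]; _∷_ to _v∷_; here to vhere; there to vthere)
open import Data.Vec.Properties using (≡-dec)
open import Data.Product using (Σ; _×_; _,_; proj₁; proj₂)
open import Data.Sum using (_⊎_; inj₁; inj₂)
open import Relation.Nullary using (¬_; Dec; yes; no; does; ¬?; _×-dec_)
open import Relation.Nullary.Decidable using (⌊_⌋; toWitness; fromWitness; isYes≗does)
open import Function using (_∘_)
open import Function.Bundles using (Equivalence)
open import Function.Definitions using (Injective)
open import Relation.Binary.PropositionalEquality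

open ≡-Reasoning

indicator : Bool → ℕ
indicator true  = 1
indicator false = 0

count : {A : Set} → (A → Bool) → List A → ℕ
count f []       = 0
count f (x ∷ xs) = indicator (f x) + count f xs

edgeCount≡count : ∀ {N} (H : Hypergraph N) → edgeCount H ≡ count H (allSubsets N)
edgeCount≡count {N} H = go (allSubsets N)
  where
  go : ∀ xs → length (filter (λ s → B.T? (H s)) xs) ≡ count H xs
  go []       = refl
  go (x ∷ xs) with H x
  ... | true  = cong suc (go xs)
  ... | false = go xs

count-cong : ∀ {A : Set} {f g : A → Bool} → (∀ x → f x ≡ g x) → ∀ xs → count f xs ≡ count g xs
count-cong f≗g []       = refl
count-cong f≗g (x ∷ xs) = cong₂ _+_ (cong indicator (f≗g x)) (count-cong f≗g xs)

count-false : ∀ {A : Set} (xs : List A) → count (λ _ → false) xs ≡ 0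
count-false []       = refl
count-false (x ∷ xs) = count-false xs

count-++ : ∀ {A : Set} (f : A → Bool) xs ys → count f (xs ++ ys) ≡ count f xs + count f ys
count-++ f []       ys = refl
count-++ f (x ∷ xs) ys = trans (cong (indicator (f x) +_) (count-++ f xs ys)) (sym (+-assoc (indicator (f x)) _ _))

count-map : ∀ {A B : Set} (f : B → Bool) (h : A → B) xs → count f (map h xs) ≡ count (f ∘ h) xs
count-map f h []       = refl
count-map f h (x ∷ xs) = cong (indicator (f (h x)) +_) (count-map f h xs)

count-∨ : ∀ {A : Set} (f g : A → Bool) → (∀ x → T (f x) → T (g x) → Empty) →
  ∀ xs → count (λ x → f x ∨ g x) xs ≡ count f xs + count g xs
count-∨ f g disjoint []       = refl
count-∨ f g disjoint (x ∷ xs) with f x | g x | disjoint x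
... | true  | true  | d = ⊥-elim (d tt tt)
... | true  | false | _ = cong suc (count-∨ f g disjoint xs)
... | false | true  | _ = trans (cong suc (count-∨ f g disjoint xs)) (sym (+-suc (count f xs) _))
... | false | false | _ = count-∨ f g disjoint xs

count-split : ∀ {A : Set} (f g : A → Bool) → (∀ x → T (g x) → T (f x)) →
  ∀ xs → count f xs ≡ count (λ x → f x ∧ not (g x)) xs + count g xs
count-split f g g⇒f xs = trans (count-cong absorb xs) (count-∨ _ g disjoint xs)
  where
  absorb : ∀ x → f x ≡ (f x ∧ not (g x)) ∨ g x
  absorb x with f x | g x | g⇒f x
  ... | true  | true  | _ = refl
  ... | true  | false | _ = refl
  ... | false | true  | h = ⊥-elim (h tt)
  ... | false | false | _ = refl
  disjoint : ∀ x → T (f x ∧ not (g x)) → T (g x) → Empty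
  disjoint x p q with g x
  ... | true = proj₂ (Equivalence.to T-∧ p)

-- ⌊_⌋ does not compute on open terms; comparing the underlying `does` does.
⌊⌋-by-does : ∀ {a b} {A : Set a} {B : Set b} (a? : Dec A) (b? : Dec B) →
  does a? ≡ does b? → ⌊ a? ⌋ ≡ ⌊ b? ⌋
⌊⌋-by-does a? b? eq = trans (isYes≗does a?) (trans eq (sym (isYes≗does b?)))

≟S-∷ : ∀ {N} x y (w c : Subset N) → _≟S_ {suc N} (x v∷ w) (y v∷ c) ≡ ⌊ x B.≟ y ⌋ ∧ (w ≟S c)
≟S-∷ x y w c = trans (isYes≗does (≡-dec B._≟_ (x v∷ w) (y v∷ c)))
                     (sym (cong₂ _∧_ (isYes≗does (x B.≟ y)) (isYes≗does (≡-dec B._≟_ w c))))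

count-allSubsets : ∀ N (f : Subset (suc N) → Bool) → count f (allSubsets (suc N)) ≡
  count (λ w → f (inside v∷ w)) (allSubsets N) + count (λ w → f (outside v∷ w)) (allSubsets N)
count-allSubsets N f = trans (count-++ f (map (inside v∷_) (allSubsets N)) _)
  (cong₂ _+_ (count-map f (inside v∷_) (allSubsets N)) (count-map f (outside v∷_) (allSubsets N)))

count-singleton : ∀ N (c : Subset N) → count (λ w → w ≟S c) (allSubsets N) ≡ 1
count-singleton zero    v[] = refl
count-singleton (suc N) (x v∷ c) = begin
  count (λ w → w ≟S (x v∷ c)) (allSubsets (suc N))
    ≡⟨ count-allSubsets N _ ⟩
  count (λ w → (inside v∷ w) ≟S (x v∷ c)) L + count (λ w → (outside v∷ w) ≟S (x v∷ c)) L
    ≡⟨ cong₂ _+_ (count-cong (λ w → ≟S-∷ inside x w c) L) (count-cong (λ w → ≟S-∷ outside x w c) L) ⟩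
  count (λ w → ⌊ inside B.≟ x ⌋ ∧ (w ≟S c)) L + count (λ w → ⌊ outside B.≟ x ⌋ ∧ (w ≟S c)) L
    ≡⟨ by-head x ⟩
  1 ∎
  where
  L = allSubsets N
  by-head : ∀ x → count (λ w → ⌊ inside B.≟ x ⌋ ∧ (w ≟S c)) L + count (λ w → ⌊ outside B.≟ x ⌋ ∧ (w ≟S c)) L ≡ 1
  by-head true  = cong₂ _+_ (count-singleton N c) (count-false L)
  by-head false = cong₂ _+_ (count-false L) (count-singleton N c)

count-size : ∀ N r → count (λ w → ⌊ ∣ w ∣ ≟ℕ r ⌋) (allSubsets N) ≡ N C r
count-size zero    zero    = refl
count-size zero    (suc r) = refl
count-size (suc N) zero    = begin
  count (λ w → ⌊ ∣ w ∣ ≟ℕ 0 ⌋) (allSubsets (suc N))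
    ≡⟨ count-allSubsets N _ ⟩
  count (λ w → ⌊ ∣ inside v∷ w ∣ ≟ℕ 0 ⌋) L + count (λ w → ⌊ ∣ w ∣ ≟ℕ 0 ⌋) L
    ≡⟨ cong (_+ count (λ w → ⌊ ∣ w ∣ ≟ℕ 0 ⌋) L) (trans (count-cong (λ w → isYes≗does (suc ∣ w ∣ ≟ℕ 0)) L) (count-false L)) ⟩
  count (λ w → ⌊ ∣ w ∣ ≟ℕ 0 ⌋) L
    ≡⟨ count-size N zero ⟩
  1 ∎
  where L = allSubsets N
count-size (suc N) (suc r) = begin
  count (λ w → ⌊ ∣ w ∣ ≟ℕ suc r ⌋) (allSubsets (suc N))
    ≡⟨ count-allSubsets N _ ⟩
  count (λ w → ⌊ ∣ inside v∷ w ∣ ≟ℕ suc r ⌋) L + count (λ w → ⌊ ∣ w ∣ ≟ℕ suc r ⌋) L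
    ≡⟨ cong (_+ count (λ w → ⌊ ∣ w ∣ ≟ℕ suc r ⌋) L) (count-cong (λ w → ⌊⌋-by-does (suc ∣ w ∣ ≟ℕ suc r) (∣ w ∣ ≟ℕ r) refl) L) ⟩
  count (λ w → ⌊ ∣ w ∣ ≟ℕ r ⌋) L + count (λ w → ⌊ ∣ w ∣ ≟ℕ suc r ⌋) L
    ≡⟨ cong₂ _+_ (count-size N r) (count-size N (suc r)) ⟩
  N C r + N C suc r
    ≡⟨ nCk+nC[k+1]≡[n+1]C[k+1] N r ⟩
  suc N C suc r ∎
  where L = allSubsets N

-- Membership of w in the family g; modifiedStar uses exactly this test.
inFamily : ∀ {N t} → (Fin t → Subset N) → Subset N → Bool
inFamily {t = t} g w = any (λ i → w ≟S g i) (allFin t)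

inFamily⁻ : ∀ {N t} (g : Fin t → Subset N) {w} → T (inFamily g w) → Σ (Fin t) λ i → w ≡ g i
inFamily⁻ g {w} p with find (Any.any⁻ (λ i → w ≟S g i) (allFin _) p)
... | i , _ , w≟gi = i , toWitness w≟gi

inFamily⁺ : ∀ {N t} (g : Fin t → Subset N) {w} i → w ≡ g i → T (inFamily g w)
inFamily⁺ g i w≡gi = Any.any⁺ _ (lose (∈-allFin i) (fromWitness w≡gi))

count-inFamily : ∀ {N t} (g : Fin t → Subset N) → Injective _≡_ _≡_ g →
  count (inFamily g) (allSubsets N) ≡ t
count-inFamily {N} {t} g g-inj = trans (over (allFin⁺ t)) (length-tabulate (λ i → i))
  where
  over : ∀ {is} → Unique is → count (λ w → any (λ i → w ≟S g i) is) (allSubsets N) ≡ length is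
  over [] = count-false (allSubsets N)
  over {i ∷ is} (i∉is ∷ unique) =
    trans (count-∨ _ _ disjoint (allSubsets N)) (cong₂ _+_ (count-singleton N (g i)) (over unique))
    where
    disjoint : ∀ w → T (w ≟S g i) → T (any (λ j → w ≟S g j) is) → Empty
    disjoint w p q with find (Any.any⁻ _ _ q)
    ... | j , j∈is , w≟gj = All.lookup i∉is j∈is (g-inj (trans (sym (toWitness p)) (toWitness w≟gj)))

x∉p-x : ∀ {N} (p : Subset N) x → x ∉ p - x
x∉p-x (b v∷ p) fzero    ()
x∉p-x (b v∷ p) (fsuc x) (vthere m) = x∉p-x p x m

∣p∣≡1+∣p-x∣ : ∀ {N} (p : Subset N) {x} → x ∈ p → ∣ p ∣ ≡ suc ∣ p - x ∣
∣p∣≡1+∣p-x∣ (inside v∷ p)  vhere      = cong suc (cong ∣_∣ (sym (p─⊥≡p p)))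
∣p∣≡1+∣p-x∣ (inside v∷ p)  (vthere m) = cong suc (∣p∣≡1+∣p-x∣ p m)
∣p∣≡1+∣p-x∣ (outside v∷ p) (vthere m) = ∣p∣≡1+∣p-x∣ p m

∣⁅x⁆∪p∣≡1+∣p∣ : ∀ {N} (x : Fin N) (p : Subset N) → x ∉ p → ∣ ⁅ x ⁆ ∪ p ∣ ≡ suc ∣ p ∣
∣⁅x⁆∪p∣≡1+∣p∣ fzero    (inside v∷ p)  x∉p = ⊥-elim (x∉p vhere)
∣⁅x⁆∪p∣≡1+∣p∣ fzero    (outside v∷ p) x∉p = cong suc (cong ∣_∣ (∪-identityˡ p))
∣⁅x⁆∪p∣≡1+∣p∣ (fsuc x) (inside v∷ p)  x∉p = cong suc (∣⁅x⁆∪p∣≡1+∣p∣ x p (x∉p ∘ vthere))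
∣⁅x⁆∪p∣≡1+∣p∣ (fsuc x) (outside v∷ p) x∉p = ∣⁅x⁆∪p∣≡1+∣p∣ x p (x∉p ∘ vthere)

⊆-size⇒≡ : ∀ {N} {p q : Subset N} → p ⊆ q → ∣ q ∣ ≤ ∣ p ∣ → p ≡ q
⊆-size⇒≡ {p = p} {q} p⊆q ∣q∣≤∣p∣ = ⊆-antisym p⊆q q⊆p
  where
  q⊆p : q ⊆ p
  q⊆p {x} x∈q with x ∈? p
  ... | yes x∈p = x∈p
  ... | no  x∉p = ⊥-elim (<⇒≱ (p⊂q⇒∣p∣<∣q∣ (p⊆q , x , x∈q , x∉p)) ∣q∣≤∣p∣)

∃-outside : ∀ {N} (A B : Subset N) → ∣ A ∣ < ∣ B ∣ → Σ (Fin N) λ x → x ∈ B × x ∉ A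
∃-outside A B ∣A∣<∣B∣ with any? (λ x → (x ∈? B) ×-dec ¬? (x ∈? A))
... | yes found = found
... | no  none  = ⊥-elim (<⇒≱ ∣A∣<∣B∣ (p⊆q⇒∣p∣≤∣q∣ B⊆A))
  where
  B⊆A : B ⊆ A
  B⊆A {x} x∈B with x ∈? A
  ... | yes x∈A = x∈A
  ... | no  x∉A = ⊥-elim (none (x , x∈B , x∉A))

remove-outsider-⊆ : ∀ {N} {A B : Subset N} {x} → A ⊆ B → ∣ B ∣ ≤ suc ∣ A ∣ → x ∈ B → x ∉ A → B - x ⊆ A
remove-outsider-⊆ {A = A} {B} {x} A⊆B ∣B∣≤1+∣A∣ x∈B x∉A {y} y∈B-x with y ∈? A
... | yes y∈A = y∈A
... | no  y∉A = ⊥-elim (<⇒≱ (s≤s (p⊂q⇒∣p∣<∣q∣ A⊂B-x)) (subst (_≤ suc ∣ A ∣) (∣p∣≡1+∣p-x∣ B x∈B) ∣B∣≤1+∣A∣))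
  where
  A⊆B-x : A ⊆ B - x
  A⊆B-x {z} z∈A = x∈p∧x≢y⇒x∈p-y (A⊆B z∈A) (λ { refl → x∉A z∈A })
  A⊂B-x : A ⊂ B - x
  A⊂B-x = A⊆B-x , y , y∈B-x , y∉A

module Residues (m : ℕ) where

  ℓ : ℕ
  ℓ = suc m

  %-absorbˡ : ∀ a b → (a % ℓ + b) % ℓ ≡ (a + b) % ℓ
  %-absorbˡ a b = begin
    (a % ℓ + b) % ℓ          ≡⟨ %-distribˡ-+ (a % ℓ) b ℓ ⟩
    (a % ℓ % ℓ + b % ℓ) % ℓ  ≡⟨ cong (λ c → (c + b % ℓ) % ℓ) (m%n%n≡m%n a ℓ) ⟩
    (a % ℓ + b % ℓ) % ℓ      ≡⟨ %-distribˡ-+ a b ℓ ⟨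
    (a + b) % ℓ              ∎

  %-absorbʳ : ∀ a b → (a + b % ℓ) % ℓ ≡ (a + b) % ℓ
  %-absorbʳ a b = begin
    (a + b % ℓ) % ℓ  ≡⟨ cong (_% ℓ) (+-comm a (b % ℓ)) ⟩
    (b % ℓ + a) % ℓ  ≡⟨ %-absorbˡ b a ⟩
    (b + a) % ℓ      ≡⟨ cong (_% ℓ) (+-comm b a) ⟩
    (a + b) % ℓ      ∎

  shift-changes-residue : ∀ a {d} → 0 < d → d < ℓ → a % ℓ ≢ (a + d) % ℓ
  shift-changes-residue a {d} 0<d d<ℓ eq with a % ℓ + d <? ℓ
  ... | yes c+d<ℓ = <⇒≢ (m<m+n c 0<d) (trans c≡[c+d]%ℓ (m<n⇒m%n≡m c+d<ℓ))
    where
    c = a % ℓ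
    c≡[c+d]%ℓ : c ≡ (c + d) % ℓ
    c≡[c+d]%ℓ = trans eq (sym (%-absorbˡ a d))
  ... | no  c+d≮ℓ = <⇒≢ e<c (sym c≡e)
    where
    c = a % ℓ
    e = c + d ∸ ℓ
    e<c : e < c
    e<c = subst (e <_) (m+n∸n≡m c ℓ) (∸-monoˡ-< (+-monoʳ-< c d<ℓ) (≮⇒≥ c+d≮ℓ))
    c≡e : c ≡ e
    c≡e = begin
      c             ≡⟨ eq ⟩
      (a + d) % ℓ   ≡⟨ %-absorbˡ a d ⟨
      (c + d) % ℓ   ≡⟨ m≤n⇒[n∸m]%m≡n%m (≮⇒≥ c+d≮ℓ) ⟨
      e % ℓ         ≡⟨ m<n⇒m%n≡m (<-trans e<c (m%n<n a ℓ)) ⟩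
      e             ∎

  offset-to : ∀ b z → Σ ℕ λ d → d < ℓ × z % ℓ ≡ (b + d) % ℓ
  offset-to b z = d , m%n<n (z + (ℓ ∸ c)) ℓ , sym reach
    where
    c = b % ℓ
    d = (z + (ℓ ∸ c)) % ℓ
    reach : (b + d) % ℓ ≡ z % ℓ
    reach = begin
      (b + d) % ℓ                ≡⟨ %-absorbˡ b d ⟨
      (c + d) % ℓ                ≡⟨ %-absorbʳ c (z + (ℓ ∸ c)) ⟩
      (c + (z + (ℓ ∸ c))) % ℓ    ≡⟨ cong (_% ℓ) (+-comm c (z + (ℓ ∸ c))) ⟩
      ((z + (ℓ ∸ c)) + c) % ℓ    ≡⟨ cong (_% ℓ) (+-assoc z (ℓ ∸ c) c) ⟩
      (z + ((ℓ ∸ c) + c)) % ℓ    ≡⟨ cong (λ e → (z + e) % ℓ) (m∸n+n≡m (<⇒≤ (m%n<n b ℓ))) ⟩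
      (z + ℓ) % ℓ                ≡⟨ [m+n]%n≡m%n z ℓ ⟩
      z % ℓ                      ∎

∈-setOf⁻ : ∀ {N} {y : Fin N} xs → y ∈ setOf xs → y ∈ₗ xs
∈-setOf⁻ []       p = ⊥-elim (∉⊥ p)
∈-setOf⁻ (x ∷ xs) p with x∈p∪q⁻ ⁅ x ⁆ (setOf xs) p
... | inj₁ q = here (x∈⁅y⁆⇒x≡y x q)
... | inj₂ q = there (∈-setOf⁻ xs q)

∈-setOf⁺ : ∀ {N} {y : Fin N} {xs} → y ∈ₗ xs → y ∈ setOf xs
∈-setOf⁺ (here refl) = x∈p∪q⁺ (inj₁ (x∈⁅x⁆ _))
∈-setOf⁺ (there p)   = x∈p∪q⁺ (inj₂ (∈-setOf⁺ p))

module CyclicSequence {N : ℕ} (k m : ℕ) (v : Fin (suc m) → Fin N) (v-inj : Injective _≡_ _≡_ v) where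

  open Residues m public

  u : ℕ → Fin N
  u x = v (x mod ℓ)

  W : ℕ → Subset N
  W s = window k m v (s mod ℓ)

  toℕ-mod : ∀ x → toℕ (x mod ℓ) ≡ x % ℓ
  toℕ-mod x = toℕ-fromℕ< (m%n<n x ℓ)

  u-cong : ∀ a b → a % ℓ ≡ b % ℓ → u a ≡ u b
  u-cong a b eq = cong v (toℕ-injective (trans (toℕ-mod a) (trans eq (sym (toℕ-mod b)))))

  u-residue : ∀ a b → u a ≡ u b → a % ℓ ≡ b % ℓ
  u-residue a b eq = trans (sym (toℕ-mod a)) (trans (cong toℕ (v-inj eq)) (toℕ-mod b))

  u-toℕ : ∀ p → u (toℕ p) ≡ v p
  u-toℕ p = cong v (toℕ-injective (trans (toℕ-mod (toℕ p)) (m<n⇒m%n≡m (toℕ<n p))))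

  u-distinct : ∀ a {d} → 0 < d → d < ℓ → u a ≢ u (a + d)
  u-distinct a 0<d d<ℓ eq = shift-changes-residue a 0<d d<ℓ (u-residue a (a + _) eq)

  u-offset : ∀ b z → Σ ℕ λ d → d < ℓ × u z ≡ u (b + d)
  u-offset b z with offset-to b z
  ... | d , d<ℓ , eq = d , d<ℓ , u-cong z (b + d) eq

  entry : ℕ → ℕ → Fin N
  entry s j = v ((toℕ (s mod ℓ) + j) mod ℓ)

  window-entry : ∀ s j → entry s j ≡ u (s + j)
  window-entry s j = u-cong (toℕ (s mod ℓ) + j) (s + j) (trans (cong (λ c → (c + j) % ℓ) (toℕ-mod s)) (%-absorbˡ s j))

  W-member⁻ : ∀ s {y} → y ∈ W s → Σ ℕ λ j → j < k × y ≡ u (s + j)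
  W-member⁻ s y∈W with ∈-map⁻ (entry s) (∈-setOf⁻ _ y∈W)
  ... | j , j∈upTo , refl = j , ∈-upTo⁻ j∈upTo , window-entry s j

  W-member⁺ : ∀ s {j} → j < k → u (s + j) ∈ W s
  W-member⁺ s j<k = subst (_∈ W s) (window-entry s _) (∈-setOf⁺ (∈-map⁺ (entry s) (∈-upTo⁺ j<k)))

fullStar⁻ : ∀ n k {w} → T (fullStar n k w) → ∣ w ∣ ≡ k × fzero ∈ w
fullStar⁻ n k {w} p with Equivalence.to (T-∧ {⌊ ∣ w ∣ ≟ℕ k ⌋}) p
... | size , centre = toWitness {a? = ∣ w ∣ ≟ℕ k} size , toWitness {a? = fzero ∈? w} centre

fullStar⁺ : ∀ n k {w} → ∣ w ∣ ≡ k → fzero ∈ w → T (fullStar n k w)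
fullStar⁺ n k {w} size centre =
  Equivalence.from (T-∧ {⌊ ∣ w ∣ ≟ℕ k ⌋}) (fromWitness {a? = ∣ w ∣ ≟ℕ k} size , fromWitness {a? = fzero ∈? w} centre)

edgeCount-fullStar : ∀ n r → edgeCount (fullStar n (suc r)) ≡ n C r
edgeCount-fullStar n r = begin
  edgeCount (fullStar n (suc r))
    ≡⟨ edgeCount≡count (fullStar n (suc r)) ⟩
  count (fullStar n (suc r)) (allSubsets (suc n))
    ≡⟨ count-allSubsets n _ ⟩
  count (λ w → fullStar n (suc r) (inside v∷ w)) L + count (λ w → fullStar n (suc r) (outside v∷ w)) L
    ≡⟨ cong₂ _+_ (count-cong with-centre L) (trans (count-cong without-centre L) (count-false L)) ⟩
  count (λ w → ⌊ ∣ w ∣ ≟ℕ r ⌋) L + 0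
    ≡⟨ +-identityʳ _ ⟩
  count (λ w → ⌊ ∣ w ∣ ≟ℕ r ⌋) L
    ≡⟨ count-size n r ⟩
  n C r ∎
  where
  L = allSubsets n
  with-centre : ∀ w → fullStar n (suc r) (inside v∷ w) ≡ ⌊ ∣ w ∣ ≟ℕ r ⌋
  with-centre w = trans (∧-identityʳ _) (⌊⌋-by-does (suc ∣ w ∣ ≟ℕ suc r) (∣ w ∣ ≟ℕ r) refl)
  without-centre : ∀ w → fullStar n (suc r) (outside v∷ w) ≡ false
  without-centre w = ∧-zeroʳ _

module ModifiedStar (n r t : ℕ) (es fs : Fin t → Subset (suc n))
  (es-size : ∀ i → ∣ es i ∣ ≡ suc r)
  (0∉es : ∀ i → fzero ∉ es i)
  (shadows-disjoint : ∀ i j → i ≢ j → (g : Subset (suc n)) → ∣ g ∣ ≡ r → g ⊆ es i → ¬ (g ⊆ es j))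
  (fs-size : ∀ i → ∣ fs i ∣ ≡ r)
  (fs⊆es : ∀ i → fs i ⊆ es i) where

  k : ℕ
  k = suc r

  star H' : Hypergraph (suc n)
  star = fullStar n k
  H'   = modifiedStar n k t es fs

  deleted : Fin t → Subset (suc n)
  deleted i = ⁅ fzero ⁆ ∪ fs i

  survivor : Subset (suc n) → Bool
  survivor w = star w ∧ not (inFamily deleted w)

  0∈deleted : ∀ i → fzero ∈ deleted i
  0∈deleted i = x∈p∪q⁺ (inj₁ (x∈⁅x⁆ fzero))

  deleted-size : ∀ i → ∣ deleted i ∣ ≡ k
  deleted-size i = trans (∣⁅x⁆∪p∣≡1+∣p∣ fzero (fs i) (0∉es i ∘ fs⊆es i)) (cong suc (fs-size i))

  edge-cases : ∀ w → T (H' w) →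
    (fzero ∈ w × ∣ w ∣ ≡ k × (∀ i → w ≢ deleted i)) ⊎ Σ (Fin t) λ i → w ≡ es i
  edge-cases w p with Equivalence.to T-∨ p
  ... | inj₂ added = inj₂ (inFamily⁻ es added)
  ... | inj₁ kept with Equivalence.to T-∧ kept
  ... | in-star , not-deleted with fullStar⁻ n k in-star
  ... | size , centre = inj₁ (centre , size , λ i eq → not-true not-deleted (inFamily⁺ deleted i eq))
    where
    not-true : ∀ {b} → T (not b) → T b → Empty
    not-true {false} _ ()

  -- Equal added or deleted edges have equal indices, by disjointness of shadows.
  es-injective : Injective _≡_ _≡_ es
  es-injective {i} {j} eq with i ≟F j
  ... | yes i≡j = i≡j
  ... | no  i≢j = ⊥-elim (shadows-disjoint i j i≢j (fs i) (fs-size i) (fs⊆es i) (subst (fs i ⊆_) eq (fs⊆es i)))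

  deleted-injective : Injective _≡_ _≡_ deleted
  deleted-injective {i} {j} eq with i ≟F j
  ... | yes i≡j = i≡j
  ... | no  i≢j = ⊥-elim (shadows-disjoint i j i≢j (fs i) (fs-size i) (fs⊆es i) fsi⊆esj)
    where
    fsi⊆esj : fs i ⊆ es j
    fsi⊆esj {y} y∈fsi with x∈p∪q⁻ ⁅ fzero ⁆ (fs j) (subst (y ∈_) eq (x∈p∪q⁺ (inj₂ y∈fsi)))
    ... | inj₁ y∈⁅0⁆ = ⊥-elim (0∉es i (fs⊆es i (subst (_∈ fs i) (x∈⁅y⁆⇒x≡y fzero y∈⁅0⁆) y∈fsi)))
    ... | inj₂ y∈fsj = fs⊆es j y∈fsj

  count-modified : edgeCount H' ≡ edgeCount star
  count-modified = begin
    edgeCount H'                                          ≡⟨ edgeCount≡count H' ⟩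
    count H' L                                            ≡⟨ count-∨ survivor (inFamily es) added-not-survivor L ⟩
    count survivor L + count (inFamily es) L              ≡⟨ cong (count survivor L +_) (count-inFamily es es-injective) ⟩
    count survivor L + t                                  ≡⟨ cong (count survivor L +_) (count-inFamily deleted deleted-injective) ⟨
    count survivor L + count (inFamily deleted) L         ≡⟨ count-split star (inFamily deleted) deleted-in-star L ⟨
    count star L                                          ≡⟨ edgeCount≡count star ⟨
    edgeCount star                                        ∎
    where
    L = allSubsets (suc n)
    added-not-survivor : ∀ w → T (survivor w) → T (inFamily es w) → Empty
    added-not-survivor w s a with inFamily⁻ es a
    ... | i , refl = 0∉es i (proj₂ (fullStar⁻ n k (proj₁ (Equivalence.to T-∧ s))))
    deleted-in-star : ∀ w → T (inFamily deleted w) → T (star w)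
    deleted-in-star w d with inFamily⁻ deleted d
    ... | i , refl = fullStar⁺ n k (deleted-size i) (0∈deleted i)

  module Cycle (m : ℕ) (v : Fin (suc m) → Fin (suc n)) (v-inj : Injective _≡_ _≡_ v)
               (k<ℓ : k < suc m) (edges : ∀ i → T (H' (window k m v i))) where

    open CyclicSequence k m v v-inj

    W-edge : ∀ s → T (H' (W s))
    W-edge s = edges (s mod ℓ)

    window-added : ∀ s → (∀ j → j < k → u (s + j) ≢ fzero) → Σ (Fin t) λ a → W s ≡ es a
    window-added s avoids with edge-cases (W s) (W-edge s)
    ... | inj₂ added = added
    ... | inj₁ (0∈W , _) with W-member⁻ s 0∈W
    ... | j , j<k , 0≡u = ⊥-elim (avoids j j<k (sym 0≡u))

    u∈W : ∀ s → u s ∈ W s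
    u∈W s = subst (λ x → u x ∈ W s) (+-identityʳ s) (W-member⁺ s (s≤s z≤n))

    no-consecutive-added : ∀ s a b → W s ≡ es a → W (suc s) ≡ es b → Empty
    no-consecutive-added s a b Ws≡ea Ws+1≡eb with a ≟F b
    ... | no a≢b = shadows-disjoint a b a≢b (es a - u s) size (p─q⊆p (es a) ⁅ u s ⁆) shared
      where
      size : ∣ es a - u s ∣ ≡ r
      size = suc-injective (trans (sym (∣p∣≡1+∣p-x∣ (es a) (subst (u s ∈_) Ws≡ea (u∈W s)))) (es-size a))
      shared : es a - u s ⊆ es b
      shared {y} y∈ea-us with W-member⁻ s (subst (y ∈_) (sym Ws≡ea) (p─q⊆p (es a) ⁅ u s ⁆ y∈ea-us))
      ... | zero  , _   , refl = ⊥-elim (x∉p-x (es a) (u s) (subst (λ x → u x ∈ es a - u s) (+-identityʳ s) y∈ea-us))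
      ... | suc j , j<k , refl = subst (_∈ es b) (cong u (sym (+-suc s j)))
                                       (subst (u (suc s + j) ∈_) Ws+1≡eb (W-member⁺ (suc s) (<-trans (n<1+n j) j<k)))
    ... | yes refl with W-member⁻ (suc s) (subst (u s ∈_) (sym Ws+1≡eb) (subst (u s ∈_) Ws≡ea (u∈W s)))
    ... | j , j<k , us≡ = u-distinct s (s≤s z≤n) (≤-<-trans j<k k<ℓ) (trans us≡ (cong u (sym (+-suc s j))))

    window-after-zero : ∀ P → u P ≡ fzero → ∀ c → c + k < ℓ → ∀ j → j < k → u (suc c + P + j) ≢ fzero
    window-after-zero P uP≡0 c c+k<ℓ j j<k uj≡0 =
      u-distinct P (s≤s z≤n) (≤-<-trans (subst (_≤ c + k) (+-suc c j) (+-monoʳ-≤ c j<k)) c+k<ℓ)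
                 (trans uP≡0 (trans (sym uj≡0) (cong u index)))
      where
      index : suc c + P + j ≡ P + suc (c + j)
      index = begin
        suc (c + P + j)  ≡⟨ cong suc (trans (cong (_+ j) (+-comm c P)) (+-assoc P c j)) ⟩
        suc (P + (c + j)) ≡⟨ +-suc P (c + j) ⟨
        P + suc (c + j)   ∎

    full-turn : ∀ P j → j < k → ℓ ≡ suc k → u P ∈ W (suc (suc P + j))
    full-turn P j j<k ℓ≡k+1 = subst (_∈ W (suc (suc P + j))) (u-cong (suc (suc P + j) + (r ∸ j)) P back-at-P)
                                                  (W-member⁺ (suc (suc P + j)) (s≤s (m∸n≤m r j)))
      where
      index : suc (suc P + j) + (r ∸ j) ≡ P + ℓ
      index = begin
        suc (suc (P + j + (r ∸ j)))   ≡⟨ cong (suc ∘ suc) (+-assoc P j (r ∸ j)) ⟩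
        suc (suc (P + (j + (r ∸ j)))) ≡⟨ cong (λ e → suc (suc (P + e))) (m+[n∸m]≡n (s≤s⁻¹ j<k)) ⟩
        suc (suc (P + r))             ≡⟨ cong suc (+-suc P r) ⟨
        suc (P + suc r)               ≡⟨ +-suc P (suc r) ⟨
        P + suc k                     ≡⟨ cong (P +_) ℓ≡k+1 ⟨
        P + ℓ                         ∎
      back-at-P : (suc (suc P + j) + (r ∸ j)) % ℓ ≡ P % ℓ
      back-at-P = trans (cong (_% ℓ) index) ([m+n]%n≡m%n P ℓ)

    -- On a cycle of length k + 1 with u P = 0 and window P + 1 equal to eₐ,
    -- the window after a point x = u (P + 1 + j) of eₐ outside fₐ consists
    -- of 0 and eₐ - x, so it lies inside the deleted edge {0} ∪ fₐ.
    window-after-outsider : ∀ P → u P ≡ fzero → ℓ ≡ suc k → ∀ a → W (suc P) ≡ es a →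
      ∀ j → j < k → u (suc P + j) ∉ fs a → W (suc (suc P + j)) ⊆ deleted a
    window-after-outsider P uP≡0 ℓ≡k+1 a W≡ea j j<k x∉fa {y} y∈W with W-member⁻ (suc (suc P + j)) y∈W
    ... | i , i<k , refl with u-offset P (suc (suc P + j) + i)
    ... | zero  , _   , y≡uP = x∈p∪q⁺ (inj₁ (subst (_∈ ⁅ fzero ⁆) (sym y≡0) (x∈⁅x⁆ fzero)))
      where
      y≡0 : u (suc (suc P + j) + i) ≡ fzero
      y≡0 = trans y≡uP (trans (cong u (+-identityʳ P)) uP≡0)
    ... | suc d , d<ℓ , y≡ = x∈p∪q⁺ (inj₂ (remove-outsider-⊆ (fs⊆es a) one-more x∈ea x∉fa y∈ea-x))
      where
      X = suc P + j
      one-more : ∣ es a ∣ ≤ suc ∣ fs a ∣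
      one-more = ≤-reflexive (trans (es-size a) (cong suc (sym (fs-size a))))
      x∈ea : u X ∈ es a
      x∈ea = subst (u X ∈_) W≡ea (W-member⁺ (suc P) j<k)
      y∈ea : u (suc X + i) ∈ es a
      y∈ea = subst (_∈ es a) (sym (trans y≡ (cong u (+-suc P d))))
                   (subst (u (suc P + d) ∈_) W≡ea (W-member⁺ (suc P) (s≤s⁻¹ (subst (suc d <_) ℓ≡k+1 d<ℓ))))
      y≢x : u (suc X + i) ≢ u X
      y≢x eq = u-distinct X (s≤s z≤n) (≤-<-trans i<k k<ℓ) (trans (sym eq) (cong u (sym (+-suc X i))))
      y∈ea-x : u (suc X + i) ∈ es a - u X
      y∈ea-x = x∈p∧x≢y⇒x∈p-y y∈ea y≢x

    -- A cycle of length k + 1 through 0 would contain the deleted edge {0} ∪ fₐ.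
    short-cycle : ∀ P → u P ≡ fzero → ℓ ≡ suc k → Empty
    short-cycle P uP≡0 ℓ≡k+1 with window-added (suc P) (window-after-zero P uP≡0 0 (subst (k <_) (sym ℓ≡k+1) (n<1+n k)))
    ... | a , W≡ea with ∃-outside (fs a) (es a) (subst₂ _<_ (sym (fs-size a)) (sym (es-size a)) (n<1+n r))
    ... | x , x∈ea , x∉fa with W-member⁻ (suc P) (subst (x ∈_) (sym W≡ea) x∈ea)
    ... | j , j<k , refl with edge-cases (W (suc (suc P + j))) (W-edge (suc (suc P + j)))
    ... | inj₂ (i , W≡ei) = 0∉es i (subst (fzero ∈_) W≡ei (subst (_∈ W (suc (suc P + j))) uP≡0 (full-turn P j j<k ℓ≡k+1)))
    ... | inj₁ (_ , size , surviving) =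
      surviving a (⊆-size⇒≡ (window-after-outsider P uP≡0 ℓ≡k+1 a W≡ea j j<k x∉fa)
                            (≤-reflexive (trans (deleted-size a) (sym size))))

    two-zero-free-windows : ∀ s → (∀ j → j < k → u (s + j) ≢ fzero) → (∀ j → j < k → u (suc s + j) ≢ fzero) → Empty
    two-zero-free-windows s avoids₀ avoids₁ with window-added s avoids₀ | window-added (suc s) avoids₁
    ... | a , Ws≡ea | b , Ws+1≡eb = no-consecutive-added s a b Ws≡ea Ws+1≡eb

    -- A zero at position P: long cycles have two zero-free windows after it.
    through-zero : ∀ P → u P ≡ fzero → Empty
    through-zero P uP≡0 with suc (suc k) ≤? ℓ
    ... | yes k+2≤ℓ = two-zero-free-windows (suc P) (window-after-zero P uP≡0 0 (<-trans (n<1+n k) k+2≤ℓ))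
                                                    (window-after-zero P uP≡0 1 k+2≤ℓ)
    ... | no  k+2≰ℓ = short-cycle P uP≡0 (≤-antisym (s≤s⁻¹ (≰⇒> k+2≰ℓ)) k<ℓ)

    no-cycle : Empty
    no-cycle with any? (λ i → v i ≟F fzero)
    ... | yes (p , vp≡0) = through-zero (toℕ p) (trans (u-toℕ p) vp≡0)
    ... | no  zero-free  = two-zero-free-windows 0 (avoids 0) (avoids 1)
      where
      avoids : ∀ s j → j < k → u (s + j) ≢ fzero
      avoids s j _ eq = zero-free (((s + j) mod ℓ) , eq)

  tight-cycle-free : TightCycleFree k H'
  tight-cycle-free zero    _   ()
  tight-cycle-free (suc m) k<ℓ (v , v-inj , edges) = Cycle.no-cycle m v v-inj k<ℓ edges

-- The lemma itself: k ≥ 2 is only needed as k ≥ 1, i.e. k = suc r.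
lemma3p3 : (n k t : ℕ) → 2 ≤ k →
  (es fs : Fin t → Subset (suc n)) →
  (∀ i → ∣ es i ∣ ≡ k) →
  (∀ i → fzero ∉ es i) →
  (∀ i j → i ≢ j → (g : Subset (suc n)) → ∣ g ∣ ≡ k ∸ 1 → g ⊆ es i → ¬ (g ⊆ es j)) →
  (∀ i → ∣ fs i ∣ ≡ k ∸ 1) →
  (∀ i → fs i ⊆ es i) →
  TightCycleFree k (modifiedStar n k t es fs)
    × edgeCount (modifiedStar n k t es fs) ≡ edgeCount (fullStar n k)
    × edgeCount (fullStar n k) ≡ n C (k ∸ 1)
lemma3p3 n zero    t ()
lemma3p3 n (suc r) t _ es fs es-size 0∉es disjoint fs-size fs⊆es =
  H'.tight-cycle-free , H'.count-modified , edgeCount-fullStar n r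
  where module H' = ModifiedStar n r t es fs es-size 0∉es disjoint fs-size fs⊆es
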